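{- Let $C_n$ be the cycle on $n\ge 3$ vertices. Then $PC(C_n)=4$ if $n\equiv 0\pmod 4$, and $PC(C_n)=3$ otherwise.
   Context: All graphs are finite, simple and undirected. A paired dominating set of $G$ is a dominating set $S$ of $G$ such that $G[S]$ has a perfect matching. Two disjoint sets $V_1,V_2\subseteq V(G)$ form a paired coalition if neither is a paired dominating set but $V_1\cup V_2$ is. A $pc$-partition of $G$ is a partition $\pi$ of $V(G)$ into nonempty sets, none a paired dominating set, such that every member of $\pi$ forms a paired coalition with some other member of $\pi$. $PC(G)$ is the maximum number of sets in a $pc$-partition of $G$ ($0$ if none exists). -}

module Defs where

open import Data.Nat using (ℕ; zero; suc; _≤_)
open import Data.Fin using (Fin; toℕ)
open import Data.Product using (Σ; ∃; _×_; _,_)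
open import Data.Sum using (_⊎_)
open import Relation.Nullary using (¬_)
open import Relation.Binary.PropositionalEquality using (_≡_; _≢_)

-- A (simple, undirected) graph on the vertex set Fin n is given by its
-- adjacency relation.  (Simplicity/symmetry hold for the concrete cycle below.)
Graph : ℕ → Set₁
Graph n = Fin n → Fin n → Set

Subset : ℕ → Set₁
Subset n = Fin n → Set

Cycle : (n : ℕ) → Graph n
Cycle n u v =
  (toℕ v ≡ suc (toℕ u)) ⊎ (toℕ u ≡ suc (toℕ v))
  ⊎ ((toℕ u ≡ 0 × suc (toℕ v) ≡ n) ⊎ (toℕ v ≡ 0 × suc (toℕ u) ≡ n))

module _ {n : ℕ} (G : Graph n) where

  Dominating : Subset n → Set
  Dominating S = ∀ v → S v ⊎ ∃ λ u → S u × G u v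

  -- G[S] has a perfect matching: a partner map M on S such that each
  -- vertex of S is matched to an adjacent vertex of S, and M is an
  -- involution on S (so the matched edges cover S exactly once).
  HasPerfectMatching : Subset n → Set
  HasPerfectMatching S =
    Σ (Fin n → Fin n) λ M → ∀ v → S v → (S (M v) × G v (M v) × M (M v) ≡ v)

  PairedDominating : Subset n → Set
  PairedDominating S = Dominating S × HasPerfectMatching S

  _∪_ : Subset n → Subset n → Subset n
  (A ∪ B) v = A v ⊎ B v

  PairedCoalition : Subset n → Subset n → Set
  PairedCoalition A B =
    ¬ PairedDominating A × ¬ PairedDominating B × PairedDominating (A ∪ B)

  -- A partition of V(G) into k nonempty sets, given by the class map f;
  -- class i is {v | f v ≡ i}.
  Class : {k : ℕ} → (Fin n → Fin k) → Fin k → Subset n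
  Class f i v = f v ≡ i

  IsPCPartition : (k : ℕ) → (Fin n → Fin k) → Set
  IsPCPartition k f =
    (∀ i → ∃ λ v → f v ≡ i)
    × (∀ i → ¬ PairedDominating (Class f i))
    × (∀ i → ∃ λ j → i ≢ j × PairedCoalition (Class f i) (Class f j))

  HasPCPartitionOfSize : ℕ → Set
  HasPCPartitionOfSize k = Σ (Fin n → Fin k) (IsPCPartition k)

  -- PC(G) = m : m is the maximum size of a pc-partition (0 if none exists).
  PCis : ℕ → Set
  PCis m =
    ((HasPCPartitionOfSize m) ⊎ (m ≡ 0 × ∀ k → ¬ HasPCPartitionOfSize k))
    × (∀ k → HasPCPartitionOfSize k → k ≤ m)

{-# OPTIONS --safe #-}
-- A class of a pc-partition of a graph of maximum degree two forms paired coalitions with at most two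
-- other classes: if B ∪ C₁, B ∪ C₂ and B ∪ C₃ were paired dominating, then so would be B, since every
-- vertex sees at most two of the Cᵢ and two of the three matching partners of a vertex of B agree.
-- Hence four classes yield two paired coalitions on disjoint pairs of classes, and two disjoint paired
-- dominating sets S, T of such a graph cover all vertices, so there are at most four classes.
-- On Cₙ each vertex of S (or T) then has exactly one neighbour on its own side, so the colouring
-- v ↦ (v ∈ S) satisfies c (v + 2) = not (c v); being n-periodic, this forces 4 ∣ n.
-- Conversely, for 4 ∣ n the residues mod 4 give a pc-partition with four classes. For odd n the classes
-- {v - 1}, {v + 1} and the rest work, and for even n ≥ 6 the classes {0, 1}, {2, 3} and the rest: the
-- unions needed are Cₙ minus a vertex (n odd) or minus an edge (n even), which are paired dominating
-- because, up to a rotation, they are an initial segment of even length.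
module Submission where

open import Data.Bool using (Bool; true; false; not)
open import Data.Bool.Properties using (not-¬; ¬-not; not-injective; not-involutive) renaming (_≟_ to _≟ᵇ_)
open import Data.Empty using (⊥-elim)
open import Data.Fin using (Fin; zero; suc; toℕ)
open import Data.Fin.Properties using (toℕ-injective; toℕ<n; toℕ-fromℕ<; injective⇒≤) renaming (_≟_ to _≟ᶠ_)
open import Data.Nat using (ℕ; zero; suc; pred; _+_; _∸_; _≤_; _<_; _%_; s≤s; z≤n; NonZero; >-nonZero)
open import Data.Nat.DivMod using (_mod_; m%n<n; m<n⇒m%n≡m; %-distribˡ-+; m%n%n≡m%n; [m+n]%n≡m%n; n%n≡0; m∣n⇒o%n%m≡o%m)
open import Data.Nat.Divisibility using (m%n≡0⇒n∣m)
open import Data.Nat.Properties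
  using (≤-trans; ≤-pred; <-≤-trans; ≤-<-trans; ≤-reflexive; ≤-antisym; <⇒≤; <⇒≢; <-irrefl; ≮⇒≥; ≤∧≢⇒<; _<?_;
         m≤n⇒m<n∨m≡n; m≤n⇒m≤1+n; n<1+n; n≤1+n; +-comm; +-assoc; +-identityʳ; +-suc;
         suc-pred; pred[n]≤n; suc[m]≤n⇒m≤pred[n]; m∸n+n≡m)
open import Data.Product using (∃; ∃₂; ∃!; _×_; _,_; proj₁; proj₂; map)
open import Data.Sum using (_⊎_; inj₁; inj₂; [_,_]; swap)
open import Function using (_∘_; id; const)
open import Relation.Binary.Definitions using (Symmetric)
open import Relation.Binary.PropositionalEquality
  using (_≡_; _≢_; refl; sym; trans; cong; subst; ≢-sym; module ≡-Reasoning)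
open import Relation.Nullary using (¬_; Dec; yes; no; does; ¬?; contradiction)
open import Relation.Nullary.Decidable using (map′; True; toWitness)
open import Relation.Unary using (Decidable; ∁; _≐_; _∪_; _∩_; _⊥_)
open import Relation.Unary.Properties using (≐-sym; ≐-trans; _∪?_)

open import Defs hiding (_∪_)

≐-pointwise : ∀ {n} {P Q : Subset n} → (∀ v → (P v → Q v) × (Q v → P v)) → P ≐ Q
≐-pointwise P⇔Q = (λ {v} → proj₁ (P⇔Q v)) , (λ {v} → proj₂ (P⇔Q v))

∩-≐ : ∀ {n} {P P′ Q Q′ : Subset n} → P ≐ P′ → Q ≐ Q′ → P ∩ Q ≐ P′ ∩ Q′
∩-≐ (P⊆P′ , P′⊆P) (Q⊆Q′ , Q′⊆Q) = map P⊆P′ Q⊆Q′ , map P′⊆P Q′⊆Q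

∁∩∁≐∁∪ : ∀ {n} {P Q : Subset n} → ∁ P ∩ ∁ Q ≐ ∁ (P ∪ Q)
∁∩∁≐∁∪ = (λ (¬p , ¬q) → [ ¬p , ¬q ]) , (λ ¬p∪q → ¬p∪q ∘ inj₁ , ¬p∪q ∘ inj₂)

-- Paired domination in an arbitrary graph

module _ {n : ℕ} {G : Graph n} where

  PairedDominating-resp-≐ : ∀ {A B} → A ≐ B → PairedDominating G A → PairedDominating G B
  PairedDominating-resp-≐ {A} {B} (A⊆B , B⊆A) (dom , M , matched) = dom′ , M , matched′
    where
    dom′ : Dominating G B
    dom′ v with dom v
    ... | inj₁ a = inj₁ (A⊆B a)
    ... | inj₂ (u , a , g) = inj₂ (u , A⊆B a , g)
    matched′ : ∀ v → B v → B (M v) × G v (M v) × M (M v) ≡ v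
    matched′ v b with matched v (B⊆A b)
    ... | a , g , e = A⊆B a , g , e

  PairedDominating-∪-comm : ∀ {A B} → PairedDominating G (A ∪ B) → PairedDominating G (B ∪ A)
  PairedDominating-∪-comm = PairedDominating-resp-≐ (swap , swap)

  undominated⇒¬PairedDominating : ∀ {S v} → ¬ S v → (∀ {u} → G u v → ¬ S u) → ¬ PairedDominating G S
  undominated⇒¬PairedDominating ¬Sv ¬Su (dom , _) with dom _
  ... | inj₁ Sv = ¬Sv Sv
  ... | inj₂ (u , Su , g) = ¬Su g Su

  isolated⇒¬PairedDominating : ∀ {S v} → S v → (∀ {u} → G v u → ¬ S u) → ¬ PairedDominating G S
  isolated⇒¬PairedDominating Sv ¬Su (_ , M , matched) with matched _ Sv
  ... | SMv , g , _ = ¬Su g SMv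

record Automorphism {n : ℕ} (G : Graph n) : Set where
  field
    to from : Fin n → Fin n
    from-to : ∀ v → from (to v) ≡ v
    to-from : ∀ v → to (from v) ≡ v
    to-adjacent : ∀ {u v} → G u v → G (to u) (to v)
    from-adjacent : ∀ {u v} → G u v → G (from u) (from v)

  to-injective : ∀ {u v} → to u ≡ to v → u ≡ v
  to-injective {u} {v} e = trans (sym (from-to u)) (trans (cong from e) (from-to v))

module _ {n : ℕ} {G : Graph n} (σ : Automorphism G) where
  open Automorphism σ

  PairedDominating-preimage : ∀ {S} → PairedDominating G S → PairedDominating G (S ∘ to)
  PairedDominating-preimage {S} (dom , M , matched) = dom′ , M′ , matched′
    where
    dom′ : Dominating G (S ∘ to)
    dom′ v with dom (to v)
    ... | inj₁ s = inj₁ s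
    ... | inj₂ (u , s , g) = inj₂ (from u , subst S (sym (to-from u)) s , subst (G _) (from-to v) (from-adjacent g))
    M′ : Fin n → Fin n
    M′ = from ∘ M ∘ to
    matched′ : ∀ v → S (to v) → S (to (M′ v)) × G v (M′ v) × M′ (M′ v) ≡ v
    matched′ v s with matched (to v) s
    ... | s′ , g , e =
      subst S (sym (to-from _)) s′ ,
      subst (λ w → G w (M′ v)) (from-to v) (from-adjacent g) ,
      trans (cong (from ∘ M) (to-from _)) (trans (cong from e) (from-to v))

  preimage-≢ : ∀ {c d} → to c ≡ d → (λ v → to v ≢ d) ≐ (_≢ c)
  preimage-≢ tc≡d = (λ tv≢d v≡c → tv≢d (trans (cong to v≡c) tc≡d)) ,
                    (λ v≢c tv≡d → v≢c (to-injective (trans tv≡d (sym tc≡d))))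

module ThreeClasses {n : ℕ} {B C : Subset n} (B? : Decidable B) (C? : Decidable C) (B⊥C : B ⊥ C) where

  label : Fin n → Fin 3
  label v with B? v | C? v
  ... | yes _ | _     = suc zero
  ... | no _  | yes _ = suc (suc zero)
  ... | no _  | no _  = zero

  Class₀ Class₁ Class₂ : Subset n
  Class₀ v = label v ≡ zero
  Class₁ v = label v ≡ suc zero
  Class₂ v = label v ≡ suc (suc zero)

  Class₁≐B : Class₁ ≐ B
  Class₁≐B = ≐-pointwise class₁⇔B
    where
    class₁⇔B : ∀ v → (Class₁ v → B v) × (B v → Class₁ v)
    class₁⇔B v with B? v | C? v
    ... | yes Bv | _ = const Bv , const refl
    ... | no ¬Bv | yes _ = (λ ()) , ⊥-elim ∘ ¬Bv
    ... | no ¬Bv | no _ = (λ ()) , ⊥-elim ∘ ¬Bv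

  Class₂≐C : Class₂ ≐ C
  Class₂≐C = ≐-pointwise class₂⇔C
    where
    class₂⇔C : ∀ v → (Class₂ v → C v) × (C v → Class₂ v)
    class₂⇔C v with B? v | C? v
    ... | yes Bv | _ = (λ ()) , (λ Cv → ⊥-elim (B⊥C (Bv , Cv)))
    ... | no _ | yes Cv = const Cv , const refl
    ... | no _ | no ¬Cv = (λ ()) , ⊥-elim ∘ ¬Cv

  Class₀≐rest : Class₀ ≐ ∁ B ∩ ∁ C
  Class₀≐rest = ≐-pointwise class₀⇔rest
    where
    class₀⇔rest : ∀ v → (Class₀ v → (∁ B ∩ ∁ C) v) × ((∁ B ∩ ∁ C) v → Class₀ v)
    class₀⇔rest v with B? v | C? v
    ... | yes Bv | _ = (λ ()) , (λ (¬Bv , _) → ⊥-elim (¬Bv Bv))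
    ... | no _ | yes Cv = (λ ()) , (λ (_ , ¬Cv) → ⊥-elim (¬Cv Cv))
    ... | no ¬Bv | no ¬Cv = const (¬Bv , ¬Cv) , const refl

  Class₀∪Class₁≐∁C : Class₀ ∪ Class₁ ≐ ∁ C
  Class₀∪Class₁≐∁C = ≐-pointwise class₀₁⇔∁C
    where
    class₀₁⇔∁C : ∀ v → ((Class₀ ∪ Class₁) v → ¬ C v) × (¬ C v → (Class₀ ∪ Class₁) v)
    class₀₁⇔∁C v with B? v | C? v
    ... | yes Bv | _ = (λ _ Cv → B⊥C (Bv , Cv)) , const (inj₂ refl)
    ... | no _ | yes Cv = (λ { (inj₁ ()) ; (inj₂ ()) }) , (λ ¬Cv → ⊥-elim (¬Cv Cv))
    ... | no _ | no ¬Cv = const ¬Cv , const (inj₁ refl)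

  Class₀∪Class₂≐∁B : Class₀ ∪ Class₂ ≐ ∁ B
  Class₀∪Class₂≐∁B = ≐-pointwise class₀₂⇔∁B
    where
    class₀₂⇔∁B : ∀ v → ((Class₀ ∪ Class₂) v → ¬ B v) × (¬ B v → (Class₀ ∪ Class₂) v)
    class₀₂⇔∁B v with B? v | C? v
    ... | yes Bv | _ = (λ { (inj₁ ()) ; (inj₂ ()) }) , (λ ¬Bv → ⊥-elim (¬Bv Bv))
    ... | no ¬Bv | yes _ = const ¬Bv , const (inj₂ refl)
    ... | no ¬Bv | no _ = const ¬Bv , const (inj₁ refl)

  -- The rest ∁ B ∩ ∁ C is the common coalition partner of B (union ∁ C) and of C (union ∁ B).
  threeClasses-pcPartition : ∀ {G : Graph n} → ∃ (∁ B ∩ ∁ C) → ∃ B → ∃ C →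
    ¬ PairedDominating G (∁ B ∩ ∁ C) → ¬ PairedDominating G B → ¬ PairedDominating G C →
    PairedDominating G (∁ C) → PairedDominating G (∁ B) → IsPCPartition G 3 label
  threeClasses-pcPartition {G} (a , Aa) (b , Bb) (c , Cc) ¬pd-A ¬pd-B ¬pd-C pd-∁C pd-∁B = nonempty , ¬pd , partner
    where
    nonempty : ∀ i → ∃ λ v → label v ≡ i
    nonempty zero = a , proj₂ Class₀≐rest Aa
    nonempty (suc zero) = b , proj₂ Class₁≐B Bb
    nonempty (suc (suc zero)) = c , proj₂ Class₂≐C Cc
    ¬pd : ∀ i → ¬ PairedDominating G (λ v → label v ≡ i)
    ¬pd zero = ¬pd-A ∘ PairedDominating-resp-≐ Class₀≐rest
    ¬pd (suc zero) = ¬pd-B ∘ PairedDominating-resp-≐ Class₁≐B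
    ¬pd (suc (suc zero)) = ¬pd-C ∘ PairedDominating-resp-≐ Class₂≐C
    pd₀₁ : PairedDominating G (Class₀ ∪ Class₁)
    pd₀₁ = PairedDominating-resp-≐ (≐-sym Class₀∪Class₁≐∁C) pd-∁C
    pd₀₂ : PairedDominating G (Class₀ ∪ Class₂)
    pd₀₂ = PairedDominating-resp-≐ (≐-sym Class₀∪Class₂≐∁B) pd-∁B
    partner : ∀ i → ∃ λ j → i ≢ j × PairedCoalition G (λ v → label v ≡ i) (λ v → label v ≡ j)
    partner zero = suc zero , (λ ()) , ¬pd zero , ¬pd (suc zero) , pd₀₁
    partner (suc zero) = zero , (λ ()) , ¬pd (suc zero) , ¬pd zero , PairedDominating-∪-comm pd₀₁
    partner (suc (suc zero)) = zero , (λ ()) , ¬pd (suc (suc zero)) , ¬pd zero , PairedDominating-∪-comm pd₀₂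

-- Graphs of maximum degree two

MaxDegree≤2 : ∀ {n} → Graph n → Set
MaxDegree≤2 G = ∀ {v a b c} → G v a → G v b → G v c → a ≡ b ⊎ a ≡ c ⊎ b ≡ c

twoNeighbours⇒MaxDegree≤2 : ∀ {n} {G : Graph n} {N₁ N₂ : Fin n → Fin n} →
                             (∀ {v w} → G v w → w ≡ N₁ v ⊎ w ≡ N₂ v) → MaxDegree≤2 G
twoNeighbours⇒MaxDegree≤2 nb ga gb gc with nb ga | nb gb | nb gc
... | inj₁ p | inj₁ q | _ = inj₁ (trans p (sym q))
... | inj₂ p | inj₂ q | _ = inj₁ (trans p (sym q))
... | inj₁ p | inj₂ _ | inj₁ r = inj₂ (inj₁ (trans p (sym r)))
... | inj₂ p | inj₁ _ | inj₂ r = inj₂ (inj₁ (trans p (sym r)))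
... | inj₁ _ | inj₂ q | inj₂ r = inj₂ (inj₂ (trans q (sym r)))
... | inj₂ _ | inj₁ q | inj₁ r = inj₂ (inj₂ (trans q (sym r)))

IsMajority : ∀ {n} → Fin n → Fin n → Fin n → Fin n → Set
IsMajority x a b c = (a ≡ x × b ≡ x) ⊎ (a ≡ x × c ≡ x) ⊎ (b ≡ x × c ≡ x)

majority : ∀ {n} → Fin n → Fin n → Fin n → Fin n
majority a b c with a ≟ᶠ b
... | yes _ = a
... | no _ = c

majority-correct : ∀ {n} {x a b c : Fin n} → IsMajority x a b c → majority a b c ≡ x
majority-correct {a = a} {b} _ with a ≟ᶠ b
majority-correct (inj₁ (a≡x , _)) | yes _ = a≡x
majority-correct (inj₂ (inj₁ (a≡x , _))) | yes _ = a≡x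
majority-correct (inj₂ (inj₂ (b≡x , _))) | yes a≡b = trans a≡b b≡x
majority-correct (inj₁ (a≡x , b≡x)) | no a≢b = contradiction (trans a≡x (sym b≡x)) a≢b
majority-correct (inj₂ (inj₁ (_ , c≡x))) | no _ = c≡x
majority-correct (inj₂ (inj₂ (_ , c≡x))) | no _ = c≡x

surjection⇒≤ : ∀ {m k} (g : Fin m → Fin k) → (∀ i → ∃ λ j → g j ≡ i) → k ≤ m
surjection⇒≤ g onto = injective⇒≤ {f = proj₁ ∘ onto} λ {i} {j} e →
  trans (sym (proj₂ (onto i))) (trans (cong g e) (proj₂ (onto j)))

two-avoiding : ∀ {k} (b : Fin (4 + k)) → ∃₂ λ x y → x ≢ y × x ≢ zero × y ≢ zero × x ≢ b × y ≢ b
two-avoiding zero = suc zero , suc (suc zero) , (λ ()) , (λ ()) , (λ ()) , (λ ()) , (λ ())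
two-avoiding (suc zero) = suc (suc zero) , suc (suc (suc zero)) , (λ ()) , (λ ()) , (λ ()) , (λ ()) , (λ ())
two-avoiding (suc (suc zero)) = suc zero , suc (suc (suc zero)) , (λ ()) , (λ ()) , (λ ()) , (λ ()) , (λ ())
two-avoiding (suc (suc (suc _))) = suc zero , suc (suc zero) , (λ ()) , (λ ()) , (λ ()) , (λ ()) , (λ ())

DisjointPairedDominatingSets : ∀ {n} → Graph n → Set₁
DisjointPairedDominatingSets {n} G =
  ∃₂ λ (S T : Subset n) → S ⊥ T × PairedDominating G S × PairedDominating G T

module MaxDegreeTwo {n : ℕ} {G : Graph n} (G-sym : Symmetric G) (deg≤2 : MaxDegree≤2 G) where

  DominatedBy : Subset n → Fin n → Set
  DominatedBy S v = S v ⊎ ∃ λ u → S u × G u v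

  NeighbourIn : Subset n → Fin n → Set
  NeighbourIn C v = ∃ λ u → C u × G v u

  no-three-disjoint-neighbours : ∀ {C₁ C₂ C₃ : Subset n} → C₁ ⊥ C₂ → C₁ ⊥ C₃ → C₂ ⊥ C₃ →
    ∀ {v} → ¬ (NeighbourIn C₁ v × NeighbourIn C₂ v × NeighbourIn C₃ v)
  no-three-disjoint-neighbours C₁⊥C₂ C₁⊥C₃ C₂⊥C₃ ((a , Ca , ga) , (b , Cb , gb) , (c , Cc , gc))
    with deg≤2 ga gb gc
  ... | inj₁ refl = C₁⊥C₂ (Ca , Cb)
  ... | inj₂ (inj₁ refl) = C₁⊥C₃ (Ca , Cc)
  ... | inj₂ (inj₂ refl) = C₂⊥C₃ (Cb , Cc)

  -- A vertex of C is handled by its partner in the matching of B ∪ C.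
  dominatedBy⊎neighbourIn : ∀ {B C} → PairedDominating G (B ∪ C) → ∀ v → DominatedBy B v ⊎ NeighbourIn C v
  dominatedBy⊎neighbourIn (dom , M , matched) v with dom v
  ... | inj₁ (inj₁ b) = inj₁ (inj₁ b)
  ... | inj₂ (u , inj₁ b , g) = inj₁ (inj₂ (u , b , g))
  ... | inj₂ (u , inj₂ c , g) = inj₂ (u , c , G-sym g)
  ... | inj₁ (inj₂ c) with matched v (inj₂ c)
  ...   | inj₁ b , g , _ = inj₁ (inj₂ (M v , b , G-sym g))
  ...   | inj₂ c′ , g , _ = inj₂ (M v , c′ , g)

  three-extensions⇒PairedDominating : ∀ {B C₁ C₂ C₃} → C₁ ⊥ C₂ → C₁ ⊥ C₃ → C₂ ⊥ C₃ →
    PairedDominating G (B ∪ C₁) → PairedDominating G (B ∪ C₂) → PairedDominating G (B ∪ C₃) →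
    PairedDominating G B
  three-extensions⇒PairedDominating {B} {C₁} {C₂} {C₃} C₁⊥C₂ C₁⊥C₃ C₂⊥C₃
    P₁@(_ , M₁ , matched₁) P₂@(_ , M₂ , matched₂) P₃@(_ , M₃ , matched₃) = dom , M , matched
    where
    dom : Dominating G B
    dom v with dominatedBy⊎neighbourIn P₁ v | dominatedBy⊎neighbourIn P₂ v | dominatedBy⊎neighbourIn P₃ v
    ... | inj₁ d | _ | _ = d
    ... | inj₂ _ | inj₁ d | _ = d
    ... | inj₂ _ | inj₂ _ | inj₁ d = d
    ... | inj₂ n₁ | inj₂ n₂ | inj₂ n₃ = ⊥-elim (no-three-disjoint-neighbours C₁⊥C₂ C₁⊥C₃ C₂⊥C₃ (n₁ , n₂ , n₃))

    M : Fin n → Fin n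
    M v = majority (M₁ v) (M₂ v) (M₃ v)

    inB : ∀ {C C′ : Subset n} {w w′} → C ⊥ C′ → (B ∪ C) w → (B ∪ C′) w′ → w ≡ w′ → B w
    inB _ (inj₁ b) _ _ = b
    inB _ (inj₂ _) (inj₁ b) refl = b
    inB C⊥C′ (inj₂ c) (inj₂ c′) refl = ⊥-elim (C⊥C′ (c , c′))

    agree : ∀ {v w} → B w → G v w → IsMajority w (M₁ v) (M₂ v) (M₃ v) → IsMajority v (M₁ w) (M₂ w) (M₃ w) →
            B (M v) × G v (M v) × M (M v) ≡ v
    agree {v} b g maj-v maj-w =
      subst (λ x → B x × G v x × M x ≡ v) (sym (majority-correct maj-v)) (b , g , majority-correct maj-w)

    -- By the degree bound two of the three partners of v coincide.
    matched : ∀ v → B v → B (M v) × G v (M v) × M (M v) ≡ v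
    matched v b with matched₁ v (inj₁ b) | matched₂ v (inj₁ b) | matched₃ v (inj₁ b)
    ... | s₁ , g₁ , e₁ | s₂ , g₂ , e₂ | s₃ , g₃ , e₃ with deg≤2 g₁ g₂ g₃
    ... | inj₁ p = agree (inB {C₁} {C₂} C₁⊥C₂ s₁ s₂ p) g₁
                         (inj₁ (refl , sym p)) (inj₁ (e₁ , trans (cong M₂ p) e₂))
    ... | inj₂ (inj₁ p) = agree (inB {C₁} {C₃} C₁⊥C₃ s₁ s₃ p) g₁
                                (inj₂ (inj₁ (refl , sym p))) (inj₂ (inj₁ (e₁ , trans (cong M₃ p) e₃)))
    ... | inj₂ (inj₂ p) = agree (inB {C₂} {C₃} C₂⊥C₃ s₂ s₃ p) g₂
                                (inj₂ (inj₂ (refl , sym p))) (inj₂ (inj₂ (e₂ , trans (cong M₃ p) e₃)))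

  -- If v ∉ S ∪ T, the T-partner of a T-neighbour w of v would be w's only other neighbour,
  -- so S could not dominate w.
  disjointPairedDominating⇒cover : ∀ {S T} → S ⊥ T → PairedDominating G S → PairedDominating G T →
                                   ∀ v → S v ⊎ T v
  disjointPairedDominating⇒cover {S} {T} S⊥T (domS , _) (domT , Mᵀ , matchedᵀ) v with domT v
  ... | inj₁ Tv = inj₂ Tv
  ... | inj₂ (w , Tw , gwv) with domS w | matchedᵀ w Tw
  ...   | inj₁ Sw | _ = ⊥-elim (S⊥T (Sw , Tw))
  ...   | inj₂ (x , Sx , gxw) | TMw , gwMw , _ with deg≤2 gwv gwMw (G-sym gxw)
  ...     | inj₁ v≡Mw = inj₂ (subst T (sym v≡Mw) TMw)
  ...     | inj₂ (inj₁ v≡x) = inj₁ (subst S (sym v≡x) Sx)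
  ...     | inj₂ (inj₂ Mw≡x) = ⊥-elim (S⊥T (subst S (sym Mw≡x) Sx , TMw))

  unique-neighbourIn : ∀ {S T} → S ⊥ T → PairedDominating G S → Dominating G T →
                       ∀ {v} → S v → ∃! _≡_ (λ w → S w × G v w)
  unique-neighbourIn {S} {T} S⊥T (_ , M , matched) domT {v} Sv with matched v Sv
  ... | SMv , gvMv , _ = M v , (SMv , gvMv) , unique
    where
    unique : ∀ {w} → S w × G v w → M v ≡ w
    unique (Sw , gvw) with domT v
    ... | inj₁ Tv = ⊥-elim (S⊥T (Sv , Tv))
    ... | inj₂ (u , Tu , guv) with deg≤2 gvMv gvw (G-sym guv)
    ...   | inj₁ Mv≡w = Mv≡w
    ...   | inj₂ (inj₁ refl) = ⊥-elim (S⊥T (SMv , Tu))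
    ...   | inj₂ (inj₂ refl) = ⊥-elim (S⊥T (Sw , Tu))

  unique-neighbourIn⇒PairedDominating : ∀ {S} → (∀ v → ∃! _≡_ (λ w → S w × G v w)) → PairedDominating G S
  unique-neighbourIn⇒PairedDominating {S} unique = dom , M , matched
    where
    M : Fin n → Fin n
    M v = proj₁ (unique v)
    dom : Dominating G S
    dom v with unique v
    ... | w , (Sw , gvw) , _ = inj₂ (w , Sw , G-sym gvw)
    matched : ∀ v → S v → S (M v) × G v (M v) × M (M v) ≡ v
    matched v Sv with unique v
    ... | w , (Sw , gvw) , _ = Sw , gvw , proj₂ (proj₂ (unique w)) (Sv , G-sym gvw)

  Coalition : ∀ {k} → (Fin n → Fin k) → Fin k → Fin k → Set
  Coalition f i j = PairedDominating G (Class G f i ∪ Class G f j)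

  Class-disjoint : ∀ {k} (f : Fin n → Fin k) {i j} → i ≢ j → Class G f i ⊥ Class G f j
  Class-disjoint f i≢j (fv≡i , fv≡j) = i≢j (trans (sym fv≡i) fv≡j)

  coalitionPartner : ∀ {k f} → IsPCPartition G k f → ∀ i → ∃ λ j → i ≢ j × Coalition f i j
  coalitionPartner (_ , _ , partnered) i with partnered i
  ... | j , i≢j , _ , _ , coalition = j , i≢j , coalition

  at-most-two-coalitionPartners : ∀ {k f} → IsPCPartition G k f → ∀ {c x y z} → x ≢ y → x ≢ z → y ≢ z →
    ¬ (Coalition f c x × Coalition f c y × Coalition f c z)
  at-most-two-coalitionPartners {f = f} (_ , ¬pd , _) {c} x≢y x≢z y≢z (Ccx , Ccy , Ccz) =
    ¬pd c (three-extensions⇒PairedDominating (Class-disjoint f x≢y) (Class-disjoint f x≢z) (Class-disjoint f y≢z)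
                                             Ccx Ccy Ccz)

  record TwoDisjointCoalitions {k} (f : Fin n → Fin k) : Set where
    constructor twoDisjointCoalitions
    field
      a b c d : Fin k
      a≢c : a ≢ c
      a≢d : a ≢ d
      b≢c : b ≢ c
      b≢d : b ≢ d
      coalition-ab : Coalition f a b
      coalition-cd : Coalition f c d

    S T : Subset n
    S = Class G f a ∪ Class G f b
    T = Class G f c ∪ Class G f d

    S⊥T : S ⊥ T
    S⊥T (inj₁ fv≡a , inj₁ fv≡c) = a≢c (trans (sym fv≡a) fv≡c)
    S⊥T (inj₁ fv≡a , inj₂ fv≡d) = a≢d (trans (sym fv≡a) fv≡d)
    S⊥T (inj₂ fv≡b , inj₁ fv≡c) = b≢c (trans (sym fv≡b) fv≡c)
    S⊥T (inj₂ fv≡b , inj₂ fv≡d) = b≢d (trans (sym fv≡b) fv≡d)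

    disjointPairedDominatingSets : DisjointPairedDominatingSets G
    disjointPairedDominatingSets = S , T , S⊥T , coalition-ab , coalition-cd

    -- Every class contains a vertex, which lies in S ∪ T.
    size≤4 : IsPCPartition G k f → k ≤ 4
    size≤4 (nonempty , _) = surjection⇒≤ choose onto
      where
      choose : Fin 4 → Fin k
      choose zero = a
      choose (suc zero) = b
      choose (suc (suc zero)) = c
      choose (suc (suc (suc zero))) = d
      onto : ∀ i → ∃ λ j → choose j ≡ i
      onto i with nonempty i
      ... | v , fv≡i with disjointPairedDominating⇒cover S⊥T coalition-ab coalition-cd v
      ...   | inj₁ (inj₁ fv≡a) = zero , trans (sym fv≡a) fv≡i
      ...   | inj₁ (inj₂ fv≡b) = suc zero , trans (sym fv≡b) fv≡i
      ...   | inj₂ (inj₁ fv≡c) = suc (suc zero) , trans (sym fv≡c) fv≡i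
      ...   | inj₂ (inj₂ fv≡d) = suc (suc (suc zero)) , trans (sym fv≡d) fv≡i

  -- Take a partner b of class 0 and two further classes x, y. If the partners of x and y both lie in
  -- {0, b}, they differ (no class has three partners), and {x, px}, {y, py} are disjoint.
  fourClasses⇒twoDisjointCoalitions : ∀ {k} {f : Fin n → Fin (4 + k)} → IsPCPartition G (4 + k) f →
                                      TwoDisjointCoalitions f
  fourClasses⇒twoDisjointCoalitions pc with coalitionPartner pc zero
  ... | b , a≢b , Cab with two-avoiding b
  ... | x , y , x≢y , x≢a , y≢a , x≢b , y≢b with coalitionPartner pc x | coalitionPartner pc y
  ... | px , _ , Cxpx | py , _ , Cypy with px ≟ᶠ zero | px ≟ᶠ b | py ≟ᶠ zero | py ≟ᶠ b
  ... | no px≢a | no px≢b | _ | _ =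
    twoDisjointCoalitions zero b x px (≢-sym x≢a) (≢-sym px≢a) (≢-sym x≢b) (≢-sym px≢b) Cab Cxpx
  ... | _ | _ | no py≢a | no py≢b =
    twoDisjointCoalitions zero b y py (≢-sym y≢a) (≢-sym py≢a) (≢-sym y≢b) (≢-sym py≢b) Cab Cypy
  ... | yes refl | _ | yes refl | _ =
    ⊥-elim (at-most-two-coalitionPartners pc x≢y x≢b y≢b
              (PairedDominating-∪-comm Cxpx , PairedDominating-∪-comm Cypy , Cab))
  ... | no _ | yes refl | no _ | yes refl =
    ⊥-elim (at-most-two-coalitionPartners pc x≢y x≢a y≢a
              (PairedDominating-∪-comm Cxpx , PairedDominating-∪-comm Cypy , PairedDominating-∪-comm Cab))
  ... | yes refl | _ | no _ | yes refl =
    twoDisjointCoalitions x zero y b x≢y x≢b (≢-sym y≢a) a≢b Cxpx Cypy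
  ... | no _ | yes refl | yes refl | _ =
    twoDisjointCoalitions x b y zero x≢y x≢a (≢-sym y≢b) (≢-sym a≢b) Cxpx Cypy

  pcPartition-bound : ∀ {k f} → IsPCPartition G k f → k ≤ 3 ⊎ (k ≤ 4 × DisjointPairedDominatingSets G)
  pcPartition-bound {0} _ = inj₁ z≤n
  pcPartition-bound {1} _ = inj₁ (s≤s z≤n)
  pcPartition-bound {2} _ = inj₁ (s≤s (s≤s z≤n))
  pcPartition-bound {3} _ = inj₁ (s≤s (s≤s (s≤s z≤n)))
  pcPartition-bound {suc (suc (suc (suc _)))} pc = inj₂ (size≤4 pc , disjointPairedDominatingSets)
    where open TwoDisjointCoalitions (fourClasses⇒twoDisjointCoalitions pc)

-- Alternating Boolean sequences

does-exactlyOne : ∀ {P Q : Set} (P? : Dec P) (Q? : Dec Q) → P ⊎ Q → ¬ (P × Q) → does Q? ≡ not (does P?)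
does-exactlyOne (yes p) (yes q) _ ¬both = ⊥-elim (¬both (p , q))
does-exactlyOne (yes _) (no _) _ _ = refl
does-exactlyOne (no _) (yes _) _ _ = refl
does-exactlyOne (no ¬p) (no _) (inj₁ p) _ = ⊥-elim (¬p p)
does-exactlyOne (no _) (no ¬q) (inj₂ q) _ = ⊥-elim (¬q q)

module _ (s : ℕ → Bool) (alternates : ∀ i → s (2 + i) ≡ not (s i)) where

  alternating-period-4 : ∀ i → s (4 + i) ≡ s i
  alternating-period-4 i = trans (alternates (2 + i)) (trans (cong not (alternates i)) (not-involutive (s i)))

  alternating-¬period-1 : ¬ (∀ i → s (1 + i) ≡ s i)
  alternating-¬period-1 period = not-¬ (trans (period 1) (period 0)) (alternates 0)

  alternating-period⇒%4≡0 : ∀ p → (∀ i → s (p + i) ≡ s i) → p % 4 ≡ 0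
  alternating-period⇒%4≡0 0 _ = refl
  alternating-period⇒%4≡0 1 period = ⊥-elim (alternating-¬period-1 period)
  alternating-period⇒%4≡0 2 period = ⊥-elim (not-¬ (period 0) (alternates 0))
  alternating-period⇒%4≡0 3 period = ⊥-elim (alternating-¬period-1 λ i →
    trans (sym (period (1 + i))) (alternating-period-4 i))
  alternating-period⇒%4≡0 (suc (suc (suc (suc p)))) period = alternating-period⇒%4≡0 p λ i →
    trans (sym (alternating-period-4 (p + i))) (period i)

low : Fin 4 → Bool
low zero = true
low (suc zero) = true
low (suc (suc _)) = false

low-+2 : ∀ r → low ((2 + toℕ r) mod 4) ≡ not (low r)
low-+2 zero = refl
low-+2 (suc zero) = refl
low-+2 (suc (suc zero)) = refl
low-+2 (suc (suc (suc zero))) = refl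

low≡true : ∀ r → low r ≡ true → r ≡ zero ⊎ r ≡ suc zero
low≡true zero _ = inj₁ refl
low≡true (suc zero) _ = inj₂ refl

low≡false : ∀ r → low r ≡ false → r ≡ suc (suc zero) ⊎ r ≡ suc (suc (suc zero))
low≡false (suc (suc zero)) _ = inj₁ refl
low≡false (suc (suc (suc zero))) _ = inj₂ refl

1+-mod4-≢ : ∀ r → (1 + toℕ r) mod 4 ≢ r
1+-mod4-≢ zero ()
1+-mod4-≢ (suc zero) ()
1+-mod4-≢ (suc (suc zero)) ()
1+-mod4-≢ (suc (suc (suc zero))) ()

-- Arithmetic

[m+n%d]%d≡[m+n]%d : ∀ m n d .{{_ : NonZero d}} → (m + n % d) % d ≡ (m + n) % d
[m+n%d]%d≡[m+n]%d m n d = begin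
  (m + n % d) % d           ≡⟨ %-distribˡ-+ m (n % d) d ⟩
  (m % d + n % d % d) % d   ≡⟨ cong (λ r → (m % d + r) % d) (m%n%n≡m%n n d) ⟩
  (m % d + n % d) % d       ≡⟨ %-distribˡ-+ m n d ⟨
  (m + n) % d               ∎
  where open ≡-Reasoning

<∧≢pred⇒<pred : ∀ {x m} → x < m → x ≢ pred m → x < pred m
<∧≢pred⇒<pred x<m = ≤∧≢⇒< (suc[m]≤n⇒m≤pred[n] x<m)

parity : ∀ m → m % 2 ≡ 0 ⊎ m % 2 ≡ 1
parity 0 = inj₁ refl
parity 1 = inj₂ refl
parity (suc (suc m)) = parity m

odd⇒pred-even : ∀ m → m % 2 ≡ 1 → pred m % 2 ≡ 0
odd⇒pred-even 1 _ = refl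
odd⇒pred-even (suc (suc (suc m))) odd = odd⇒pred-even (suc m) odd

even⇒pred²-even : ∀ m → m % 2 ≡ 0 → pred (pred m) % 2 ≡ 0
even⇒pred²-even 0 _ = refl
even⇒pred²-even (suc (suc m)) even = even

even∧≢4⇒6≤ : ∀ {m} → 3 ≤ m → m % 2 ≡ 0 → m ≢ 4 → 6 ≤ m
even∧≢4⇒6≤ {2} (s≤s (s≤s ())) _ _
even∧≢4⇒6≤ {3} _ () _
even∧≢4⇒6≤ {4} _ _ m≢4 = contradiction refl m≢4
even∧≢4⇒6≤ {5} _ () _
even∧≢4⇒6≤ {suc (suc (suc (suc (suc (suc _)))))} _ _ _ = s≤s (s≤s (s≤s (s≤s (s≤s (s≤s z≤n)))))

-- x xor 1: the partner of x in the pairing {0, 1}, {2, 3}, …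
mate : ℕ → ℕ
mate 0 = 1
mate 1 = 0
mate (suc (suc x)) = 2 + mate x

mate-involutive : ∀ x → mate (mate x) ≡ x
mate-involutive 0 = refl
mate-involutive 1 = refl
mate-involutive (suc (suc x)) = cong (2 +_) (mate-involutive x)

mate-adjacent : ∀ x → mate x ≡ suc x ⊎ x ≡ suc (mate x)
mate-adjacent 0 = inj₁ refl
mate-adjacent 1 = inj₂ refl
mate-adjacent (suc (suc x)) with mate-adjacent x
... | inj₁ e = inj₁ (cong (2 +_) e)
... | inj₂ e = inj₂ (cong (2 +_) e)

mate-< : ∀ {x m} → m % 2 ≡ 0 → x < m → mate x < m
mate-< {0} {suc (suc _)} _ _ = s≤s (s≤s z≤n)
mate-< {1} {suc (suc _)} _ _ = s≤s z≤n
mate-< {1} {1} _ (s≤s ())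
mate-< {suc (suc _)} {suc (suc _)} even (s≤s (s≤s x<m)) = s≤s (s≤s (mate-< even x<m))

-- The cycle Cₙ

module CycleGraph (n : ℕ) (3≤n : 3 ≤ n) where

  instance
    n-nonZero : NonZero n
    n-nonZero = >-nonZero (≤-trans (s≤s z≤n) 3≤n)

  vertex : ℕ → Fin n
  vertex i = i mod n

  toℕ-vertex : ∀ i → toℕ (vertex i) ≡ i % n
  toℕ-vertex i = toℕ-fromℕ< (m%n<n i n)

  toℕ-vertex-< : ∀ {i} → i < n → toℕ (vertex i) ≡ i
  toℕ-vertex-< {i} i<n = trans (toℕ-vertex i) (m<n⇒m%n≡m i<n)

  vertex-toℕ : ∀ v → vertex (toℕ v) ≡ v
  vertex-toℕ v = toℕ-injective (toℕ-vertex-< (toℕ<n v))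

  vertex-≡ : ∀ {i v} → i < n → toℕ v ≡ i → v ≡ vertex i
  vertex-≡ i<n v≡i = toℕ-injective (trans v≡i (sym (toℕ-vertex-< i<n)))

  vertex-cong : ∀ {i j} → i % n ≡ j % n → vertex i ≡ vertex j
  vertex-cong {i} {j} e = toℕ-injective (trans (toℕ-vertex i) (trans e (sym (toℕ-vertex j))))

  vertex-n+ : ∀ i → vertex (n + i) ≡ vertex i
  vertex-n+ i = vertex-cong (trans (cong (_% n) (+-comm n i)) ([m+n]%n≡m%n i n))

  rotate : ℕ → Fin n → Fin n
  rotate k v = vertex (k + toℕ v)

  rotate-vertex : ∀ k i → rotate k (vertex i) ≡ vertex (k + i)
  rotate-vertex k i = trans (cong (λ r → vertex (k + r)) (toℕ-vertex i)) (vertex-cong ([m+n%d]%d≡[m+n]%d k i n))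

  rotate-rotate : ∀ j k v → rotate j (rotate k v) ≡ rotate (j + k) v
  rotate-rotate j k v = trans (rotate-vertex j (k + toℕ v)) (cong vertex (sym (+-assoc j k (toℕ v))))

  rotate-comm : ∀ j k v → rotate j (rotate k v) ≡ rotate k (rotate j v)
  rotate-comm j k v =
    trans (rotate-rotate j k v) (trans (cong (λ r → rotate r v) (+-comm j k)) (sym (rotate-rotate k j v)))

  rotate-inverse : ∀ {j k} → j + k ≡ n → ∀ v → rotate j (rotate k v) ≡ v
  rotate-inverse j+k≡n v =
    trans (rotate-rotate _ _ v) (trans (cong (λ r → rotate r v) j+k≡n) (trans (vertex-n+ (toℕ v)) (vertex-toℕ v)))

  rotate-to-zero : ∀ v → rotate (n ∸ toℕ v) v ≡ vertex 0
  rotate-to-zero v = begin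
    vertex (n ∸ toℕ v + toℕ v)  ≡⟨ cong vertex (m∸n+n≡m (<⇒≤ (toℕ<n v))) ⟩
    vertex n                    ≡⟨ cong vertex (+-identityʳ n) ⟨
    vertex (n + 0)              ≡⟨ vertex-n+ 0 ⟩
    vertex 0                    ∎
    where open ≡-Reasoning

  rotate-≢ : ∀ {k} → 0 < k → k < n → ∀ v → rotate k v ≢ v
  rotate-≢ {k} 0<k k<n v rotate-k-v≡v = <⇒≢ 0<k (begin
    0                                  ≡⟨ toℕ-vertex-< (≤-<-trans z≤n k<n) ⟨
    toℕ (vertex 0)                     ≡⟨ cong toℕ (rotate-to-zero v) ⟨
    toℕ (rotate x v)                   ≡⟨ cong (toℕ ∘ rotate x) rotate-k-v≡v ⟨
    toℕ (rotate x (rotate k v))        ≡⟨ cong toℕ (rotate-comm x k v) ⟩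
    toℕ (rotate k (rotate x v))        ≡⟨ cong (toℕ ∘ rotate k) (rotate-to-zero v) ⟩
    toℕ (rotate k (vertex 0))          ≡⟨ cong toℕ (rotate-vertex k 0) ⟩
    toℕ (vertex (k + 0))               ≡⟨ cong (toℕ ∘ vertex) (+-identityʳ k) ⟩
    toℕ (vertex k)                     ≡⟨ toℕ-vertex-< k<n ⟩
    k                                  ∎)
    where
    open ≡-Reasoning
    x = n ∸ toℕ v

  vertex-+-≢ : ∀ {k} → 0 < k → k < n → ∀ i → vertex (k + i) ≢ vertex i
  vertex-+-≢ 0<k k<n i e = rotate-≢ 0<k k<n (vertex i) (trans (rotate-vertex _ i) e)

  next prev : Fin n → Fin n
  next = rotate 1
  prev = rotate (pred n)

  prev-next : ∀ v → prev (next v) ≡ v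
  prev-next = rotate-inverse (trans (+-comm (pred n) 1) (suc-pred n))

  next-prev : ∀ v → next (prev v) ≡ v
  next-prev = rotate-inverse (suc-pred n)

  next-vertex : ∀ i → next (vertex i) ≡ vertex (suc i)
  next-vertex = rotate-vertex 1

  prev-vertex : ∀ i → prev (vertex (suc i)) ≡ vertex i
  prev-vertex i = trans (cong prev (sym (next-vertex i))) (prev-next (vertex i))

  next≢self : ∀ v → next v ≢ v
  next≢self = rotate-≢ (s≤s z≤n) (≤-trans (s≤s (s≤s z≤n)) 3≤n)

  prev≢self : ∀ v → prev v ≢ v
  prev≢self = rotate-≢ (suc[m]≤n⇒m≤pred[n] (≤-trans (s≤s (s≤s z≤n)) 3≤n)) (≤-reflexive (suc-pred n))

  prev≢next : ∀ v → prev v ≢ next v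
  prev≢next v prev≡next = rotate-≢ (s≤s z≤n) 3≤n (prev v) (begin
    rotate 2 (prev v)          ≡⟨ rotate-rotate 1 1 (prev v) ⟨
    next (next (prev v))       ≡⟨ cong next (next-prev v) ⟩
    next v                     ≡⟨ prev≡next ⟨
    prev v                     ∎)
    where open ≡-Reasoning

  next-≡ : ∀ {u v} → suc (toℕ u) % n ≡ toℕ v → next u ≡ v
  next-≡ e = toℕ-injective (trans (toℕ-vertex _) e)

  adjacent-next : ∀ v → Cycle n v (next v)
  adjacent-next v with m≤n⇒m<n∨m≡n (toℕ<n v)
  ... | inj₁ 1+v<n = inj₁ (trans (toℕ-vertex _) (m<n⇒m%n≡m 1+v<n))
  ... | inj₂ 1+v≡n = inj₂ (inj₂ (inj₂ (trans (toℕ-vertex _) (trans (cong (_% n) 1+v≡n) (n%n≡0 n)) , 1+v≡n)))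

  adjacent⇒next : ∀ {u v} → Cycle n u v → v ≡ next u ⊎ u ≡ next v
  adjacent⇒next {u} {v} (inj₁ v≡1+u) =
    inj₁ (sym (next-≡ (trans (cong (_% n) (sym v≡1+u)) (m<n⇒m%n≡m (toℕ<n v)))))
  adjacent⇒next {u} {v} (inj₂ (inj₁ u≡1+v)) =
    inj₂ (sym (next-≡ (trans (cong (_% n) (sym u≡1+v)) (m<n⇒m%n≡m (toℕ<n u)))))
  adjacent⇒next (inj₂ (inj₂ (inj₁ (u≡0 , 1+v≡n)))) =
    inj₂ (sym (next-≡ (trans (cong (_% n) 1+v≡n) (trans (n%n≡0 n) (sym u≡0)))))
  adjacent⇒next (inj₂ (inj₂ (inj₂ (v≡0 , 1+u≡n)))) =
    inj₁ (sym (next-≡ (trans (cong (_% n) 1+u≡n) (trans (n%n≡0 n) (sym v≡0)))))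

  Cycle-sym : Symmetric (Cycle n)
  Cycle-sym (inj₁ e) = inj₂ (inj₁ e)
  Cycle-sym (inj₂ (inj₁ e)) = inj₁ e
  Cycle-sym (inj₂ (inj₂ (inj₁ e))) = inj₂ (inj₂ (inj₂ e))
  Cycle-sym (inj₂ (inj₂ (inj₂ e))) = inj₂ (inj₂ (inj₁ e))

  adjacent-prev : ∀ v → Cycle n v (prev v)
  adjacent-prev v = Cycle-sym (subst (Cycle n (prev v)) (next-prev v) (adjacent-next (prev v)))

  adjacent⇒next⊎prev : ∀ {v w} → Cycle n v w → w ≡ next v ⊎ w ≡ prev v
  adjacent⇒next⊎prev {v} {w} g with adjacent⇒next g
  ... | inj₁ w≡next-v = inj₁ w≡next-v
  ... | inj₂ v≡next-w = inj₂ (trans (sym (prev-next w)) (cong prev (sym v≡next-w)))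

  ¬adjacent-self : ∀ {v} → ¬ Cycle n v v
  ¬adjacent-self {v} g with adjacent⇒next⊎prev g
  ... | inj₁ v≡next = next≢self v (sym v≡next)
  ... | inj₂ v≡prev = prev≢self v (sym v≡prev)

  Cycle-maxDegree≤2 : MaxDegree≤2 (Cycle n)
  Cycle-maxDegree≤2 = twoNeighbours⇒MaxDegree≤2 {N₁ = next} {N₂ = prev} adjacent⇒next⊎prev

  open MaxDegreeTwo Cycle-sym Cycle-maxDegree≤2

  rotate-adjacent : ∀ j {u v} → Cycle n u v → Cycle n (rotate j u) (rotate j v)
  rotate-adjacent j {u} {v} g with adjacent⇒next g
  ... | inj₁ refl = subst (Cycle n (rotate j u)) (rotate-comm 1 j u) (adjacent-next (rotate j u))
  ... | inj₂ refl = Cycle-sym (subst (Cycle n (rotate j v)) (rotate-comm 1 j v) (adjacent-next (rotate j v)))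

  rotation : ∀ {j k} → j + k ≡ n → Automorphism (Cycle n)
  rotation {j} {k} j+k≡n = record
    { to = rotate j
    ; from = rotate k
    ; from-to = rotate-inverse (trans (+-comm k j) j+k≡n)
    ; to-from = rotate-inverse j+k≡n
    ; to-adjacent = rotate-adjacent j
    ; from-adjacent = rotate-adjacent k
    }

  last : Fin n
  last = vertex (pred n)

  rotationToLast : Fin n → Automorphism (Cycle n)
  rotationToLast d = rotation {n ∸ suc (toℕ d)} {suc (toℕ d)} (m∸n+n≡m (toℕ<n d))

  rotationToLast-sends : ∀ d → Automorphism.to (rotationToLast d) d ≡ last
  rotationToLast-sends d = cong (vertex ∘ pred) (trans (sym (+-suc _ (toℕ d))) (m∸n+n≡m (toℕ<n d)))

  isolated-at : ∀ {X} v → X v → ¬ X (prev v) → ¬ X (next v) → ¬ PairedDominating (Cycle n) X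
  isolated-at {X} v Xv ¬X-prev ¬X-next = isolated⇒¬PairedDominating Xv ¬X-neighbour
    where
    ¬X-neighbour : ∀ {u} → Cycle n v u → ¬ X u
    ¬X-neighbour g with adjacent⇒next⊎prev g
    ... | inj₁ refl = ¬X-next
    ... | inj₂ refl = ¬X-prev

  undominated-at : ∀ {X} v → ¬ X v → ¬ X (prev v) → ¬ X (next v) → ¬ PairedDominating (Cycle n) X
  undominated-at {X} v ¬Xv ¬X-prev ¬X-next = undominated⇒¬PairedDominating ¬Xv ¬X-neighbour
    where
    ¬X-neighbour : ∀ {u} → Cycle n u v → ¬ X u
    ¬X-neighbour g with adjacent⇒next⊎prev (Cycle-sym g)
    ... | inj₁ refl = ¬X-next
    ... | inj₂ refl = ¬X-prev

  singleton-¬pairedDominating : ∀ v → ¬ PairedDominating (Cycle n) (_≡ v)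
  singleton-¬pairedDominating v =
    isolated⇒¬PairedDominating refl λ g u≡v → ¬adjacent-self (subst (Cycle n v) u≡v g)

  Alternating : (Fin n → Bool) → Set
  Alternating c = ∀ v → c (next (next v)) ≡ not (c v)

  module _ {c : Fin n → Bool} (alternating : Alternating c) where

    alternating-next : ∀ v → c (next v) ≡ not (c (prev v))
    alternating-next v = trans (cong (c ∘ next) (sym (next-prev v))) (alternating (prev v))

    alternating⇒%4≡0 : n % 4 ≡ 0
    alternating⇒%4≡0 = alternating-period⇒%4≡0 (c ∘ vertex) alternates n (λ i → cong c (vertex-n+ i))
      where
      alternates : ∀ i → c (vertex (2 + i)) ≡ not (c (vertex i))
      alternates i = trans (cong c (trans (sym (rotate-vertex 2 i)) (sym (rotate-rotate 1 1 (vertex i)))))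
                           (alternating (vertex i))

    -- Of the two neighbours prev v and next v exactly one has colour b.
    alternating⇒pairedDominating : ∀ b → PairedDominating (Cycle n) (λ v → c v ≡ b)
    alternating⇒pairedDominating b = unique-neighbourIn⇒PairedDominating unique
      where
      unique : ∀ v → ∃! _≡_ (λ w → c w ≡ b × Cycle n v w)
      unique v with c (prev v) ≟ᵇ b
      ... | yes prev≡b = prev v , (prev≡b , adjacent-prev v) , only-prev
        where
        only-prev : ∀ {w} → c w ≡ b × Cycle n v w → prev v ≡ w
        only-prev (cw≡b , g) with adjacent⇒next⊎prev g
        ... | inj₂ w≡prev = sym w≡prev
        ... | inj₁ refl = ⊥-elim (not-¬ refl (trans (sym cw≡b) (trans (alternating-next v) (cong not prev≡b))))
      ... | no prev≢b = next v , (next≡b , adjacent-next v) , only-next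
        where
        next≡b : c (next v) ≡ b
        next≡b = trans (alternating-next v) (trans (cong not (¬-not prev≢b)) (not-involutive b))
        only-next : ∀ {w} → c w ≡ b × Cycle n v w → next v ≡ w
        only-next (cw≡b , g) with adjacent⇒next⊎prev g
        ... | inj₁ w≡next = sym w≡next
        ... | inj₂ refl = ⊥-elim (prev≢b cw≡b)

  prev-xor-next : ∀ {X Y} (X? : Decidable X) → X ⊥ Y → PairedDominating (Cycle n) X → Dominating (Cycle n) Y →
                  ∀ {u} → X u → does (X? (next u)) ≡ not (does (X? (prev u)))
  prev-xor-next {X} X? X⊥Y X-pd Y-dom {u} Xu with unique-neighbourIn X⊥Y X-pd Y-dom Xu
  ... | w , (Xw , g) , unique = does-exactlyOne (X? (prev u)) (X? (next u)) one not-both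
    where
    one : X (prev u) ⊎ X (next u)
    one with adjacent⇒next⊎prev g
    ... | inj₁ w≡next = inj₂ (subst X w≡next Xw)
    ... | inj₂ w≡prev = inj₁ (subst X w≡prev Xw)
    not-both : ¬ (X (prev u) × X (next u))
    not-both (X-prev , X-next) =
      prev≢next u (trans (sym (unique (X-prev , adjacent-prev u))) (unique (X-next , adjacent-next u)))

  disjointPairedDominating⇒alternating : DisjointPairedDominatingSets (Cycle n) → ∃ Alternating
  disjointPairedDominating⇒alternating (S , T , S⊥T , S-pd , T-pd) = does ∘ S? , alternating
    where
    cover = disjointPairedDominating⇒cover S⊥T S-pd T-pd

    S? : Decidable S
    S? v with cover v
    ... | inj₁ Sv = yes Sv
    ... | inj₂ Tv = no (λ Sv → S⊥T (Sv , Tv))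

    T? : Decidable T
    T? v = map′ (λ ¬Sv → [ ⊥-elim ∘ ¬Sv , id ] (cover v)) (λ Tv Sv → S⊥T (Sv , Tv)) (¬? (S? v))

    around : ∀ u → does (S? (next u)) ≡ not (does (S? (prev u)))
    around u with cover u
    ... | inj₁ Su = prev-xor-next S? S⊥T S-pd (proj₁ T-pd) Su
    ... | inj₂ Tu = not-injective (prev-xor-next T? (λ (Tv , Sv) → S⊥T (Sv , Tv)) T-pd (proj₁ S-pd) Tu)

    alternating : Alternating (does ∘ S?)
    alternating v = subst (λ w → does (S? (next (next v))) ≡ not (does (S? w))) (prev-next v) (around (next v))

  prefix-pairedDominating : ∀ {m} → m % 2 ≡ 0 → 0 < m → m ≤ n → n ≤ 2 + m →
                            PairedDominating (Cycle n) (λ v → toℕ v < m)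
  prefix-pairedDominating {zero} _ () _ _
  prefix-pairedDominating {m@(suc m′)} even _ m≤n n≤2+m = dom , M , matched
    where
    M : Fin n → Fin n
    M v = vertex (mate (toℕ v))

    matched : ∀ v → toℕ v < m → toℕ (M v) < m × Cycle n v (M v) × M (M v) ≡ v
    matched v v<m = subst (_< m) (sym toℕ-Mv) y<m , adjacent (mate-adjacent (toℕ v)) , involutive
      where
      y<m = mate-< even v<m
      toℕ-Mv : toℕ (M v) ≡ mate (toℕ v)
      toℕ-Mv = toℕ-vertex-< (<-≤-trans y<m m≤n)
      adjacent : mate (toℕ v) ≡ suc (toℕ v) ⊎ toℕ v ≡ suc (mate (toℕ v)) → Cycle n v (M v)
      adjacent (inj₁ e) = inj₁ (trans toℕ-Mv e)
      adjacent (inj₂ e) = inj₂ (inj₁ (trans e (cong suc (sym toℕ-Mv))))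
      involutive : M (M v) ≡ v
      involutive = trans (cong (vertex ∘ mate) toℕ-Mv)
                         (trans (cong vertex (mate-involutive (toℕ v))) (vertex-toℕ v))

    -- Outside the prefix lie only m, dominated by m - 1, and possibly m + 1 = n - 1, dominated by 0.
    dom : Dominating (Cycle n) (λ v → toℕ v < m)
    dom v with toℕ v <? m
    ... | yes v<m = inj₁ v<m
    ... | no v≮m with m≤n⇒m<n∨m≡n (≮⇒≥ v≮m)
    ...   | inj₂ m≡v = inj₂ (vertex m′ , subst (_< m) (sym toℕ-u) (n<1+n m′) , inj₁ v≡1+u)
      where
      toℕ-u : toℕ (vertex m′) ≡ m′
      toℕ-u = toℕ-vertex-< (<-≤-trans (n<1+n m′) m≤n)
      v≡1+u : toℕ v ≡ suc (toℕ (vertex m′))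
      v≡1+u = trans (sym m≡v) (cong suc (sym toℕ-u))
    ...   | inj₁ m<v = inj₂ (vertex 0 , subst (_< m) (sym toℕ-0) (s≤s z≤n) , inj₂ (inj₂ (inj₁ (toℕ-0 , 1+v≡n))))
      where
      toℕ-0 : toℕ (vertex 0) ≡ 0
      toℕ-0 = toℕ-vertex-< (≤-trans (s≤s z≤n) 3≤n)
      1+v≡n : suc (toℕ v) ≡ n
      1+v≡n = ≤-antisym (toℕ<n v) (≤-trans n≤2+m (s≤s m<v))

  2+pred-pred-n≡n : 2 + pred (pred n) ≡ n
  2+pred-pred-n≡n = shape 3≤n
    where
    shape : ∀ {m} → 3 ≤ m → 2 + pred (pred m) ≡ m
    shape (s≤s (s≤s (s≤s _))) = refl

  pred-n<n : pred n < n
  pred-n<n = ≤-reflexive (suc-pred n)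

  prev-last : prev last ≡ vertex (pred (pred n))
  prev-last = trans (cong prev (sym next-second-last)) (prev-next _)
    where
    next-second-last : next (vertex (pred (pred n))) ≡ last
    next-second-last = trans (next-vertex _) (cong (vertex ∘ pred) 2+pred-pred-n≡n)

  below-last : (λ v → toℕ v < pred n) ≐ (_≢ last)
  below-last = (λ v<pn v≡last → <-irrefl (trans (cong toℕ v≡last) (toℕ-vertex-< pred-n<n)) v<pn) ,
               (λ {v} v≢last → <∧≢pred⇒<pred (toℕ<n v) (v≢last ∘ vertex-≡ pred-n<n))

  below-last-two : (λ v → toℕ v < pred (pred n)) ≐ (_≢ prev last) ∩ (_≢ last)
  below-last-two = ⊆ , ⊇
    where
    ppn<n : pred (pred n) < n
    ppn<n = ≤-<-trans pred[n]≤n pred-n<n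
    ⊆ : ∀ {v} → toℕ v < pred (pred n) → v ≢ prev last × v ≢ last
    ⊆ v<ppn = (λ v≡pl → <-irrefl (trans (cong toℕ (trans v≡pl prev-last)) (toℕ-vertex-< ppn<n)) v<ppn) ,
              (λ v≡l → <⇒≢ (<-≤-trans v<ppn pred[n]≤n) (trans (cong toℕ v≡l) (toℕ-vertex-< pred-n<n)))
    ⊇ : ∀ {v} → v ≢ prev last × v ≢ last → toℕ v < pred (pred n)
    ⊇ {v} (v≢pl , v≢l) = <∧≢pred⇒<pred (<∧≢pred⇒<pred (toℕ<n v) (v≢l ∘ vertex-≡ pred-n<n))
                                       (λ e → v≢pl (trans (vertex-≡ ppn<n e) (sym prev-last)))

  deleteVertex-pairedDominating : n % 2 ≡ 1 → ∀ c → PairedDominating (Cycle n) (_≢ c)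
  deleteVertex-pairedDominating odd c =
    PairedDominating-resp-≐ (preimage-≢ σ (rotationToLast-sends c)) (PairedDominating-preimage σ without-last)
    where
    σ = rotationToLast c
    without-last : PairedDominating (Cycle n) (_≢ last)
    without-last = PairedDominating-resp-≐ below-last
      (prefix-pairedDominating (odd⇒pred-even n odd) (≤-trans (s≤s z≤n) (suc[m]≤n⇒m≤pred[n] 3≤n)) pred[n]≤n
                               (≤-trans (≤-reflexive (sym (suc-pred n))) (n≤1+n _)))

  deleteEdge-pairedDominating : n % 2 ≡ 0 → ∀ d → PairedDominating (Cycle n) (∁ ((_≡ d) ∪ (_≡ next d)))
  deleteEdge-pairedDominating even d =
    PairedDominating-resp-≐ (≐-trans (∩-≐ (preimage-≢ σ σd) (preimage-≢ σ σ-next-d)) ∁∩∁≐∁∪)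
                            (PairedDominating-preimage σ without-last-two)
    where
    σ = rotationToLast (next d)
    open Automorphism σ using (to)
    σ-next-d : to (next d) ≡ last
    σ-next-d = rotationToLast-sends (next d)
    σd : to d ≡ prev last
    σd = trans (cong to (sym (prev-next d))) (trans (rotate-comm _ (pred n) (next d)) (cong prev σ-next-d))
    without-last-two : PairedDominating (Cycle n) ((_≢ prev last) ∩ (_≢ last))
    without-last-two = PairedDominating-resp-≐ below-last-two
      (prefix-pairedDominating (even⇒pred²-even n even) (≤-pred (≤-pred (subst (3 ≤_) (sym 2+pred-pred-n≡n) 3≤n)))
                               (≤-trans pred[n]≤n pred[n]≤n) (≤-reflexive (sym 2+pred-pred-n≡n)))

  oddCycle-threePartition : n % 2 ≡ 1 → HasPCPartitionOfSize (Cycle n) 3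
  oddCycle-threePartition odd =
    label , threeClasses-pcPartition (a , a∈rest) (prev a , refl) (next a , refl)
                                     (isolated-at a a∈rest (λ (¬B , _) → ¬B refl) (λ (_ , ¬C) → ¬C refl))
                                     (singleton-¬pairedDominating (prev a)) (singleton-¬pairedDominating (next a))
                                     (deleteVertex-pairedDominating odd (next a))
                                     (deleteVertex-pairedDominating odd (prev a))
    where
    a = vertex 0
    open ThreeClasses (_≟ᶠ prev a) (_≟ᶠ next a) (λ (p , q) → prev≢next a (trans (sym p) q))
    a∈rest : (∁ (_≡ prev a) ∩ ∁ (_≡ next a)) a
    a∈rest = prev≢self a ∘ sym , next≢self a ∘ sym

  evenCycle-threePartition : n % 2 ≡ 0 → 6 ≤ n → HasPCPartitionOfSize (Cycle n) 3
  evenCycle-threePartition even 6≤n =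
    label , threeClasses-pcPartition (vertex 4 , [ apart 4 , apart 3 ] , [ apart 2 , apart 1 ])
                                     (vertex 0 , inj₁ refl) (vertex 2 , inj₁ refl) ¬pd-rest ¬pd-Edge0 ¬pd-Edge2
                                     (deleteEdge 2) (deleteEdge 0)
    where
    apart : ∀ k {i} {0<k : True (0 <? k)} {k<6 : True (k <? 6)} → vertex (k + i) ≢ vertex i
    apart k {i} {0<k} {k<6} = vertex-+-≢ (toWitness 0<k) (<-≤-trans (toWitness k<6) 6≤n) i

    Edge : ℕ → Subset n
    Edge i = (_≡ vertex i) ∪ (_≡ vertex (suc i))

    deleteEdge : ∀ i → PairedDominating (Cycle n) (∁ (Edge i))
    deleteEdge i = subst (λ w → PairedDominating (Cycle n) (∁ ((_≡ vertex i) ∪ (_≡ w)))) (next-vertex i)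
                         (deleteEdge-pairedDominating even (vertex i))

    Edge0⊥Edge2 : Edge 0 ⊥ Edge 2
    Edge0⊥Edge2 (inj₁ refl , inj₁ e) = apart 2 (sym e)
    Edge0⊥Edge2 (inj₁ refl , inj₂ e) = apart 3 (sym e)
    Edge0⊥Edge2 (inj₂ refl , inj₁ e) = apart 1 (sym e)
    Edge0⊥Edge2 (inj₂ refl , inj₂ e) = apart 2 (sym e)

    open ThreeClasses ((_≟ᶠ vertex 0) ∪? (_≟ᶠ vertex 1)) ((_≟ᶠ vertex 2) ∪? (_≟ᶠ vertex 3)) Edge0⊥Edge2

    ¬at : ∀ {X : Subset n} {v w} → v ≡ w → ¬ X w → ¬ X v
    ¬at {X} v≡w ¬Xw Xv = ¬Xw (subst X v≡w Xv)

    ¬pd-rest : ¬ PairedDominating (Cycle n) (∁ (Edge 0) ∩ ∁ (Edge 2))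
    ¬pd-rest = undominated-at (vertex 1) (λ (¬B , _) → ¬B (inj₂ refl))
                              (λ (¬B , _) → ¬B (inj₁ (prev-vertex 0))) (λ (_ , ¬C) → ¬C (inj₁ (next-vertex 1)))

    ¬pd-Edge0 : ¬ PairedDominating (Cycle n) (Edge 0)
    ¬pd-Edge0 = undominated-at (vertex 3) [ apart 3 , apart 2 ]
                               (¬at {Edge 0} (prev-vertex 2) [ apart 2 , apart 1 ])
                               (¬at {Edge 0} (next-vertex 3) [ apart 4 , apart 3 ])

    ¬pd-Edge2 : ¬ PairedDominating (Cycle n) (Edge 2)
    ¬pd-Edge2 = undominated-at (vertex 5) [ apart 3 , apart 2 ]
                               (¬at {Edge 2} (prev-vertex 4) [ apart 2 , apart 1 ])
                               (¬at {Edge 2} (next-vertex 5) [ apart 4 , apart 3 ])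

  module _ (n%4≡0 : n % 4 ≡ 0) where

    residue : Fin n → Fin 4
    residue v = toℕ v mod 4

    Residue : Fin 4 → Subset n
    Residue r v = residue v ≡ r

    toℕ-residue-vertex : ∀ i → toℕ (residue (vertex i)) ≡ i % 4
    toℕ-residue-vertex i = trans (toℕ-fromℕ< _)
      (trans (cong (_% 4) (toℕ-vertex i)) (m∣n⇒o%n%m≡o%m 4 n i (m%n≡0⇒n∣m n 4 n%4≡0)))

    residue-rotate : ∀ k v → residue (rotate k v) ≡ (k + toℕ (residue v)) mod 4
    residue-rotate k v = toℕ-injective (begin
      toℕ (residue (vertex (k + toℕ v)))   ≡⟨ toℕ-residue-vertex (k + toℕ v) ⟩
      (k + toℕ v) % 4                      ≡⟨ [m+n%d]%d≡[m+n]%d k (toℕ v) 4 ⟨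
      (k + toℕ v % 4) % 4                  ≡⟨ cong (λ r → (k + r) % 4) (toℕ-fromℕ< _) ⟨
      (k + toℕ (residue v)) % 4            ≡⟨ toℕ-fromℕ< _ ⟨
      toℕ ((k + toℕ (residue v)) mod 4)    ∎)
      where open ≡-Reasoning

    residue-vertex-toℕ : ∀ r → residue (vertex (toℕ r)) ≡ r
    residue-vertex-toℕ r = toℕ-injective (trans (toℕ-residue-vertex (toℕ r)) (m<n⇒m%n≡m (toℕ<n r)))

    residue-next-≢ : ∀ v → residue (next v) ≢ residue v
    residue-next-≢ v e = 1+-mod4-≢ (residue v) (trans (sym (residue-rotate 1 v)) e)

    residue-alternating : Alternating (low ∘ residue)
    residue-alternating v = trans (cong (low ∘ residue) (rotate-rotate 1 1 v))
                                  (trans (cong low (residue-rotate 2 v)) (low-+2 (residue v)))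

    Residue-¬pairedDominating : ∀ r → ¬ PairedDominating (Cycle n) (Residue r)
    Residue-¬pairedDominating r = isolated-at v (residue-vertex-toℕ r)
      (λ e → residue-next-≢ (prev v) (trans (cong residue (next-prev v)) (trans (residue-vertex-toℕ r) (sym e))))
      (λ e → residue-next-≢ v (trans e (sym (residue-vertex-toℕ r))))
      where v = vertex (toℕ r)

    Residue₀∪Residue₁-pairedDominating : PairedDominating (Cycle n) (Residue zero ∪ Residue (suc zero))
    Residue₀∪Residue₁-pairedDominating = PairedDominating-resp-≐
      ((λ {v} → low≡true (residue v)) , [ cong low , cong low ])
      (alternating⇒pairedDominating residue-alternating true)

    Residue₂∪Residue₃-pairedDominating :
      PairedDominating (Cycle n) (Residue (suc (suc zero)) ∪ Residue (suc (suc (suc zero))))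
    Residue₂∪Residue₃-pairedDominating = PairedDominating-resp-≐
      ((λ {v} → low≡false (residue v)) , [ cong low , cong low ])
      (alternating⇒pairedDominating residue-alternating false)

    fourPartition : HasPCPartitionOfSize (Cycle n) 4
    fourPartition = residue , (λ r → vertex (toℕ r) , residue-vertex-toℕ r) , Residue-¬pairedDominating , partner
      where
      coalition : ∀ r s → r ≢ s → PairedDominating (Cycle n) (Residue r ∪ Residue s) →
                  ∃ λ t → r ≢ t × PairedCoalition (Cycle n) (Residue r) (Residue t)
      coalition r s r≢s pd = s , r≢s , Residue-¬pairedDominating r , Residue-¬pairedDominating s , pd
      partner : ∀ r → ∃ λ s → r ≢ s × PairedCoalition (Cycle n) (Residue r) (Residue s)
      partner zero = coalition _ (suc zero) (λ ()) Residue₀∪Residue₁-pairedDominating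
      partner (suc zero) = coalition _ zero (λ ()) (PairedDominating-∪-comm Residue₀∪Residue₁-pairedDominating)
      partner (suc (suc zero)) = coalition _ (suc (suc (suc zero))) (λ ()) Residue₂∪Residue₃-pairedDominating
      partner (suc (suc (suc zero))) =
        coalition _ (suc (suc zero)) (λ ()) (PairedDominating-∪-comm Residue₂∪Residue₃-pairedDominating)

  threePartition : n ≢ 4 → HasPCPartitionOfSize (Cycle n) 3
  threePartition n≢4 with parity n
  ... | inj₁ even = evenCycle-threePartition even (even∧≢4⇒6≤ 3≤n even n≢4)
  ... | inj₂ odd = oddCycle-threePartition odd

  pcPartition-≤4 : ∀ {k f} → IsPCPartition (Cycle n) k f → k ≤ 4
  pcPartition-≤4 pc with pcPartition-bound pc
  ... | inj₁ k≤3 = m≤n⇒m≤1+n k≤3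
  ... | inj₂ (k≤4 , _) = k≤4

  pcPartition-≤3 : n % 4 ≢ 0 → ∀ {k f} → IsPCPartition (Cycle n) k f → k ≤ 3
  pcPartition-≤3 n%4≢0 pc with pcPartition-bound pc
  ... | inj₁ k≤3 = k≤3
  ... | inj₂ (_ , disjoint) =
    contradiction (alternating⇒%4≡0 (proj₂ (disjointPairedDominating⇒alternating disjoint))) n%4≢0

mainTheorem3 : (n : ℕ) → 3 ≤ n →
    (n % 4 ≡ 0 → PCis (Cycle n) 4) × (n % 4 ≢ 0 → PCis (Cycle n) 3)
mainTheorem3 n 3≤n =
  (λ n%4≡0 → inj₁ (fourPartition n%4≡0) , λ _ (_ , pc) → pcPartition-≤4 pc) ,
  (λ n%4≢0 → inj₁ (threePartition (n%4≢0 ∘ cong (_% 4))) , λ _ (_ , pc) → pcPartition-≤3 n%4≢0 pc)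
  where open CycleGraph n 3≤n
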